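{- Let $r\geq 1$ and $n_1,\ldots,n_r>1$ be integers, let $R=\mathbb{Z}_{n_1}\oplus\cdots\oplus \mathbb{Z}_{n_r}$ and let $\mathcal{S}_R$ be the multiplicative semigroup of $R$. Let $a,b\in\mathcal{S}_R$. Then: (i) If $a \leqq_{\mathcal{H}} b$, then $\gcd(\kappa_i(\theta_b),n_i)\mid \gcd(\kappa_i(\theta_a),n_i)$ for each $i\in [1,r]$, and ${\rm St}(b)\subseteq{\rm St}(a)$. (ii) $a \,\mathcal{H}\, b$ if and only if $\gcd(\kappa_i(\theta_b),n_i)= \gcd(\kappa_i(\theta_a),n_i)$ for each $i\in [1,r]$. (iii) Suppose $a <_{\mathcal{H}} b$. If there exists an index $t\in [1,r]$ such that either ${\rm pot}_{p}(\gcd(\kappa_t(\theta_b), n_t))<{\rm pot}_{p}(\gcd(\kappa_t(\theta_a), n_t))$ for some prime $p>2$, or ${\rm pot}_2(\gcd(\kappa_t(\theta_b), n_t))<{\rm pot}_2(\gcd(\kappa_t(\theta_a), n_t))< {\rm pot}_2(n_t)$, then ${\rm St}(b)\subsetneq {\rm St}(a)$.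
   Context: $\mathcal{S}_R$ is $R$ with ring multiplication as the (commutative, unitary) semigroup operation; its identity is $(\overline1,\ldots,\overline1)$, and ${\rm U}(\mathcal{S}_R)$ denotes its group of units. For ${\bf a}\in\mathcal{S}_R$, $\theta_{\bf a}=(a_1,\ldots,a_r)\in[1,n_1]\times\cdots\times[1,n_r]$ is the unique tuple of integers with ${\bf a}=(\overline{a}_1,\ldots,\overline{a}_r)$, and $\kappa_i(\theta_{\bf a})=a_i$. For $c\in\mathcal{S}_R$, ${\rm St}(c)=\{u\in{\rm U}(\mathcal{S}_R): uc=c\}$. Green's preorder: $a\leqq_{\mathcal{H}} b$ iff $a=b$ or $a=bc$ for some $c\in\mathcal{S}_R$; $a\,\mathcal{H}\,b$ iff $a\leqq_{\mathcal{H}}b$ and $b\leqq_{\mathcal{H}}a$; $a<_{\mathcal{H}}b$ means $a\leqq_{\mathcal{H}}b$ but not $a\,\mathcal{H}\,b$. For a prime $p$ and nonzero integer $n$, ${\rm pot}_p(n)$ is the largest $k$ with $p^k\mid n$. -}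

module Defs where

open import Data.Nat using (ℕ; zero; suc; _*_; _%_; _<_; _≤?_; _≟_; _>_; z<s; >-nonZero)
open import Data.Nat.Properties using (<-trans)
open import Data.Nat.DivMod using (m%n<n)
open import Data.Nat.Divisibility using (_∣_; _∣?_; divides)
open import Data.Fin using (Fin; toℕ; fromℕ<)
open import Data.Product using (Σ; ∃; _×_; _,_)
open import Data.Sum using (_⊎_)
open import Relation.Nullary using (¬_; yes; no)
open import Relation.Binary.PropositionalEquality using (_≡_)

-- pot p m : the largest k with p ^ k ∣ m (for a prime p and m ≠ 0).
-- Computed by repeatedly dividing out p; the fuel m suffices since
-- p ^ k ≤ m.  (Returns 0 in the degenerate cases p ≤ 1 or m = 0,
-- which never occur in the statement.)
potAux : ℕ → ℕ → ℕ → ℕ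
potAux zero    p m = 0
potAux (suc f) p m with p ≤? 1 | m ≟ 0 | p ∣? m
... | yes _ | _     | _                  = 0
... | no _  | yes _ | _                  = 0
... | no _  | no _  | yes (divides q _)  = suc (potAux f p q)
... | no _  | no _  | no _               = 0

pot : ℕ → ℕ → ℕ
pot p m = potAux m p m

-- The ring R = ℤ_{n_1} ⊕ ... ⊕ ℤ_{n_r} (indices i : Fin r), with
-- n i > 1, viewed as its multiplicative semigroup S_R.
module Setup (r : ℕ) (n : Fin r → ℕ) (h : ∀ i → 1 < n i) where

  S : Set
  S = (i : Fin r) → Fin (n i)

  _≈_ : S → S → Set
  a ≈ b = ∀ i → a i ≡ b i

  _·_ : S → S → S
  (a · b) i =
    let instance _ = >-nonZero (<-trans z<s (h i)) in
    fromℕ< (m%n<n (toℕ (a i) * toℕ (b i)) (n i))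

  one : S
  one i = fromℕ< (h i)

  IsUnit : S → Set
  IsUnit u = ∃ λ v → (u · v) ≈ one

  St : S → S → Set
  St c u = IsUnit u × ((u · c) ≈ c)

  -- θ_a : the representatives in [1, n_i]
  θ : S → Fin r → ℕ
  θ a i with toℕ (a i) ≟ 0
  ... | yes _ = n i
  ... | no _  = toℕ (a i)

  κ : Fin r → (Fin r → ℕ) → ℕ
  κ i t = t i

  _≤H_ : S → S → Set
  a ≤H b = (a ≈ b) ⊎ (∃ λ c → a ≈ (b · c))

  _H_ : S → S → Set
  a H b = (a ≤H b) × (b ≤H a)

  _<H_ : S → S → Set
  a <H b = (a ≤H b) × ¬ (a H b)

  _⊆St_ : (S → Set) → (S → Set) → Set
  P ⊆St Q = ∀ u → P u → Q u

  _⊊St_ : (S → Set) → (S → Set) → Set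
  P ⊊St Q = (P ⊆St Q) × (∃ λ u → Q u × ¬ P u)

-- Everything happens coordinatewise in the rings ℤ_d.  There, b·c reaches
-- exactly the residues divisible by gcd(b,d) (Bézout), which gives (i) and
-- (ii).  For (iii), p^k with k = 1 + pot_p(gcd(b,d)) divides gcd(a,d) but
-- not b; write d = M p^k.  A unit w = 1 + xM with p ∤ x fixes a (since
-- d ∣ M a) but moves b (otherwise p^k ∣ x b).  Such an x with p ∤ 1 + xM
-- exists when p is odd (take x = 1 or x = 2), and also when p ∣ M (take
-- x = 1), which is what the hypothesis on pot_2(n_t) provides for p = 2.

module Submission where

open import Data.Empty using (⊥-elim)
open import Data.Fin using (Fin; toℕ; fromℕ<)
open import Data.Fin.Properties using (toℕ-fromℕ<; toℕ-injective; toℕ<n)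
  renaming (_≟_ to _≟ᶠ_)
open import Data.List using (_∷_; [])
open import Data.Nat
open import Data.Nat.Coprimality using (Coprime; coprime-Bézout; coprime-divisor)
  renaming (sym to coprime-sym)
open import Data.Nat.DivMod
open import Data.Nat.Divisibility
open import Data.Nat.GCD
open import Data.Nat.Primality using (Prime; prime[2]; prime⇒irreducible; prime⇒nonZero; prime⇒nonTrivial)
open import Data.Nat.Properties
open import Data.Nat.Tactic.RingSolver using (solve)
open import Data.Product using (∃; _×_; _,_; proj₁; proj₂)
open import Data.Sum using (_⊎_; inj₁; inj₂; map₂)
open import Data.Vec.Functional using (updateAt)
open import Data.Vec.Functional.Properties using (updateAt-updates; updateAt-minimal)
open import Function using (_∘_)
open import Relation.Binary.PropositionalEquality
open import Relation.Nullary using (¬_; yes; no)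

open import Defs

[m%d*n]%d≡[m*n]%d : ∀ m n d .{{_ : NonZero d}} → m % d * n % d ≡ m * n % d
[m%d*n]%d≡[m*n]%d m n d = begin
  m % d * n % d            ≡⟨ %-distribˡ-* (m % d) n d ⟩
  m % d % d * (n % d) % d  ≡⟨ cong (λ x → x * (n % d) % d) (m%n%n≡m%n m d) ⟩
  m % d * (n % d) % d      ≡⟨ %-distribˡ-* m n d ⟨
  m * n % d                ∎
  where open ≡-Reasoning

[m*[n%d]]%d≡[m*n]%d : ∀ m n d .{{_ : NonZero d}} → m * (n % d) % d ≡ m * n % d
[m*[n%d]]%d≡[m*n]%d m n d = begin
  m * (n % d) % d  ≡⟨ cong (_% d) (*-comm m (n % d)) ⟩
  n % d * m % d    ≡⟨ [m%d*n]%d≡[m*n]%d n m d ⟩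
  n * m % d        ≡⟨ cong (_% d) (*-comm n m) ⟩
  m * n % d        ∎
  where open ≡-Reasoning

[m+n]%d≡m%d⇒d∣n : ∀ m n d .{{_ : NonZero d}} → (m + n) % d ≡ m % d → d ∣ n
[m+n]%d≡m%d⇒d∣n m n d eq = divides ((m + n) / d ∸ m / d) (begin
  n                                               ≡⟨ m+n∸m≡n m n ⟨
  m + n ∸ m                                       ≡⟨ cong₂ _∸_ (m≡m%n+[m/n]*n (m + n) d) (m≡m%n+[m/n]*n m d) ⟩
  ((m + n) % d + (m + n) / d * d) ∸ (m % d + m / d * d)
                                                  ≡⟨ cong (λ x → (x + (m + n) / d * d) ∸ (m % d + m / d * d)) eq ⟩
  (m % d + (m + n) / d * d) ∸ (m % d + m / d * d) ≡⟨ [m+n]∸[m+o]≡n∸o (m % d) _ _ ⟩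
  (m + n) / d * d ∸ m / d * d                     ≡⟨ *-distribʳ-∸ d ((m + n) / d) (m / d) ⟨
  ((m + n) / d ∸ m / d) * d                       ∎)
  where open ≡-Reasoning

bézout⇒solvable : ∀ {g m d} .{{_ : NonZero d}} → Bézout.Identity g m d →
                  ∃ λ x → m * x % d ≡ g % d
bézout⇒solvable {g} {m} {d} (Bézout.+- x y eq) = x , (begin
  m * x % d      ≡⟨ cong (_% d) (trans (*-comm m x) (sym eq)) ⟩
  (g + y * d) % d ≡⟨ [m+kn]%n≡m%n g y d ⟩
  g % d          ∎)
  where open ≡-Reasoning
-- From g + x m = y d, multiplying by d - 1 gives m (x (d - 1)) ≡ g (mod d).
bézout⇒solvable {g} {m} {suc k} (Bézout.-+ x y eq) = x * k , (begin
  m * (x * k) % d             ≡⟨ [m+kn]%n≡m%n (m * (x * k)) g d ⟨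
  (m * (x * k) + g * d) % d   ≡⟨ cong (_% d) expand ⟩
  ((g + x * m) * k + g) % d   ≡⟨ cong (λ z → (z * k + g) % d) eq ⟩
  (y * d * k + g) % d         ≡⟨ cong (_% d) regroup ⟩
  (g + y * k * d) % d         ≡⟨ [m+kn]%n≡m%n g (y * k) d ⟩
  g % d                       ∎)
  where
  open ≡-Reasoning
  d = suc k
  expand : m * (x * k) + g * suc k ≡ (g + x * m) * k + g
  expand = solve (m ∷ x ∷ k ∷ g ∷ [])
  regroup : y * suc k * k + g ≡ g + y * k * suc k
  regroup = solve (y ∷ k ∷ g ∷ [])

gcd∣⇒solvable : ∀ m n d .{{_ : NonZero d}} → gcd m d ∣ n → ∃ λ x → m * x % d ≡ n % d
gcd∣⇒solvable m n d (divides q n≡q*g) with bézout⇒solvable (Bézout.identity (gcd-GCD m d))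
... | x , mx≡g = x * q , (begin
  m * (x * q) % d        ≡⟨ cong (_% d) (*-assoc m x q) ⟨
  m * x * q % d          ≡⟨ [m%d*n]%d≡[m*n]%d (m * x) q d ⟨
  m * x % d * q % d      ≡⟨ cong (λ z → z * q % d) mx≡g ⟩
  gcd m d % d * q % d    ≡⟨ [m%d*n]%d≡[m*n]%d (gcd m d) q d ⟩
  gcd m d * q % d        ≡⟨ cong (_% d) (trans (*-comm (gcd m d) q) (sym n≡q*g)) ⟩
  n % d                  ∎)
  where open ≡-Reasoning

gcd∣gcd[m*n%d] : ∀ m n d .{{_ : NonZero d}} → gcd m d ∣ gcd (m * n % d) d
gcd∣gcd[m*n%d] m n d = gcd-greatest
  (%-presˡ-∣ (∣m⇒∣m*n n (gcd[m,n]∣m m d)) (gcd[m,n]∣n m d))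
  (gcd[m,n]∣n m d)

gcd[n,n]≡gcd[0,n] : ∀ n → gcd n n ≡ gcd 0 n
gcd[n,n]≡gcd[0,n] n = trans
  (∣-antisym (gcd[m,n]∣m n n) (gcd-greatest ∣-refl ∣-refl))
  (sym (gcd-identityˡ n))

coprime-* : ∀ {m n o} → Coprime m n → Coprime m o → Coprime m (n * o)
coprime-* m⊥n m⊥o {i} (i∣m , i∣no) =
  m⊥o (i∣m , coprime-divisor (λ (j∣i , j∣n) → m⊥n (∣-trans j∣i i∣m , j∣n)) i∣no)

prime∤⇒coprime : ∀ {p m} → Prime p → ¬ p ∣ m → Coprime m p
prime∤⇒coprime p-prime p∤m (i∣m , i∣p) with prime⇒irreducible p-prime i∣p
... | inj₁ i≡1  = i≡1
... | inj₂ refl = ⊥-elim (p∤m i∣m)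

prime∤⇒coprime-^ : ∀ {p m} k → Prime p → ¬ p ∣ m → Coprime m (p ^ k)
prime∤⇒coprime-^ zero    _       _   (_ , i∣1) = ∣1⇒≡1 i∣1
prime∤⇒coprime-^ (suc k) p-prime p∤m =
  coprime-* (prime∤⇒coprime p-prime p∤m) (prime∤⇒coprime-^ k p-prime p∤m)

prime∤1 : ∀ {p} → Prime p → ¬ p ∣ 1
prime∤1 p-prime p∣1 = nonTrivial⇒≢1 {{prime⇒nonTrivial p-prime}} (∣1⇒≡1 p∣1)

^-monoʳ-∣ : ∀ p {m n} → m ≤ n → p ^ m ∣ p ^ n
^-monoʳ-∣ p {m} {n} m≤n = divides (p ^ (n ∸ m)) (begin
  p ^ n                ≡⟨ cong (p ^_) (m+[n∸m]≡n m≤n) ⟨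
  p ^ (m + (n ∸ m))    ≡⟨ ^-distribˡ-+-* p m (n ∸ m) ⟩
  p ^ m * p ^ (n ∸ m)  ≡⟨ *-comm (p ^ m) _ ⟩
  p ^ (n ∸ m) * p ^ m  ∎)
  where open ≡-Reasoning

p^potAux∣m : ∀ f p m → p ^ potAux f p m ∣ m
p^potAux∣m zero    p m = 1∣ m
p^potAux∣m (suc f) p m with p ≤? 1 | m ≟ 0 | p ∣? m
... | yes _ | _     | _                      = 1∣ m
... | no _  | yes _ | _                      = 1∣ m
... | no _  | no _  | yes (divides q m≡q*p) = subst (p * p ^ potAux f p q ∣_)
      (trans (*-comm p q) (sym m≡q*p)) (*-monoʳ-∣ p (p^potAux∣m f p q))
... | no _  | no _  | no _                   = 1∣ m

p^[1+potAux]∤m : ∀ f p m → m ≤ f → 1 < p → m ≢ 0 → ¬ p ^ suc (potAux f p m) ∣ m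
p^[1+potAux]∤m zero    p m m≤0 _ m≢0 _ = m≢0 (n≤0⇒n≡0 m≤0)
p^[1+potAux]∤m (suc f) p m m≤f 1<p m≢0 with p ≤? 1 | m ≟ 0 | p ∣? m
... | yes p≤1 | _       | _ = ⊥-elim (<⇒≱ 1<p p≤1)
... | no _    | yes m≡0 | _ = ⊥-elim (m≢0 m≡0)
... | no _    | no _    | yes (divides q m≡q*p) = λ p^[2+e]∣m →
      p^[1+potAux]∤m f p q q≤f 1<p q≢0
        (*-cancelʳ-∣ p {{>-nonZero (<-trans z<s 1<p)}}
          (subst (p ^ suc (potAux f p q) * p ∣_) m≡q*p
            (subst (_∣ m) (*-comm p _) p^[2+e]∣m)))
  where
  q≢0 : q ≢ 0
  q≢0 refl = m≢0 m≡q*p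
  q≤f : q ≤ f
  q≤f = ≤-pred (≤-trans (subst (q <_) (sym m≡q*p) (m<m*n q p {{≢-nonZero q≢0}} 1<p)) m≤f)
... | no _    | no _    | no p∤m = p∤m ∘ ∣-trans (m∣m*n 1)

≤pot⇒p^k∣ : ∀ p m {k} → k ≤ pot p m → p ^ k ∣ m
≤pot⇒p^k∣ p m k≤pot = ∣-trans (^-monoʳ-∣ p k≤pot) (p^potAux∣m m p m)

pot<⇒p^k∤ : ∀ {p m k} → Prime p → m ≢ 0 → pot p m < k → ¬ p ^ k ∣ m
pot<⇒p^k∤ {p} {m} p-prime m≢0 pot<k p^k∣m =
  p^[1+potAux]∤m m p m ≤-refl (nonTrivial⇒n>1 p {{prime⇒nonTrivial p-prime}}) m≢0
    (∣-trans (^-monoʳ-∣ p pot<k) p^k∣m)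

module _ (d : ℕ) .{{_ : NonZero d}} where

  Invertible : ℕ → Set
  Invertible w = ∃ λ v → w * v % d ≡ 1 % d

  Fixes : ℕ → ℕ → Set
  Fixes w x = w * x % d ≡ x % d

  Separates : ℕ → ℕ → Set
  Separates x y = ∃ λ w → Invertible w × Fixes w x × ¬ Fixes w y

1-invertible : ∀ d .{{_ : NonZero d}} → Invertible d 1
1-invertible d = 1 , refl

1-fixes : ∀ d .{{_ : NonZero d}} x → Fixes d 1 x
1-fixes d x = cong (_% d) (*-identityˡ x)

coprime⇒invertible : ∀ {w d} .{{_ : NonZero d}} → Coprime w d → Invertible d w
coprime⇒invertible = bézout⇒solvable ∘ coprime-Bézout

∣1+x*M⇒∣M⇒∣1 : ∀ {i} x M → i ∣ 1 + x * M → i ∣ M → i ∣ 1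
∣1+x*M⇒∣M⇒∣1 {i} x M i∣1+x*M i∣M =
  ∣m+n∣m⇒∣n (subst (i ∣_) (+-comm 1 (x * M)) i∣1+x*M) (∣n⇒∣m*n x i∣M)

module Units-1+x*M {p M x : ℕ} where

  [1+x*M]*y≡y+x*[M*y] : ∀ y → (1 + x * M) * y ≡ y + x * (M * y)
  [1+x*M]*y≡y+x*[M*y] y = solve (x ∷ M ∷ y ∷ [])

  x*[M*y]≡M*[x*y] : ∀ y → x * (M * y) ≡ M * (x * y)
  x*[M*y]≡M*[x*y] y = solve (x ∷ M ∷ y ∷ [])

  1+x*M-invertible : ∀ {d k} .{{_ : NonZero d}} → Prime p → d ≡ M * p ^ k →
                     ¬ p ∣ 1 + x * M → Invertible d (1 + x * M)
  1+x*M-invertible {k = k} p-prime refl p∤w =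
    coprime⇒invertible (coprime-* w⊥M (prime∤⇒coprime-^ k p-prime p∤w))
    where
    w⊥M : Coprime (1 + x * M) M
    w⊥M (i∣w , i∣M) = ∣1⇒≡1 (∣1+x*M⇒∣M⇒∣1 x M i∣w i∣M)

  1+x*M-fixes : ∀ {d a} .{{_ : NonZero d}} → d ∣ M * a → Fixes d (1 + x * M) a
  1+x*M-fixes {d} {a} d∣M*a = trans (cong (_% d) ([1+x*M]*y≡y+x*[M*y] a))
    (%-remove-+ʳ a (∣n⇒∣m*n x d∣M*a))

  1+x*M-fixes⇒p^k∣ : ∀ {d k b} .{{_ : NonZero d}} → Prime p → d ≡ M * p ^ k → ¬ p ∣ x →
                     Fixes d (1 + x * M) b → p ^ k ∣ b
  1+x*M-fixes⇒p^k∣ {d} {k} {b} p-prime d≡M*p^k p∤x fixes =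
    coprime-divisor (coprime-sym (prime∤⇒coprime-^ k p-prime p∤x))
      (*-cancelˡ-∣ M {{M-nonZero}} (subst₂ _∣_ d≡M*p^k (x*[M*y]≡M*[x*y] b) d∣x*[M*b]))
    where
    d∣x*[M*b] : d ∣ x * (M * b)
    d∣x*[M*b] = [m+n]%d≡m%d⇒d∣n b _ d (trans (cong (_% d) (sym ([1+x*M]*y≡y+x*[M*y] b))) fixes)
    M-nonZero : NonZero M
    M-nonZero = ≢-nonZero λ { refl → ≢-nonZero⁻¹ d d≡M*p^k }

  1+x*M-separates : ∀ {d k a b} .{{_ : NonZero d}} → Prime p → d ≡ M * p ^ k →
                    p ^ k ∣ a → ¬ p ^ k ∣ b → ¬ p ∣ x → ¬ p ∣ 1 + x * M → Separates d a b
  1+x*M-separates {k = k} {a} p-prime d≡M*p^k p^k∣a p^k∤b p∤x p∤w =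
    1 + x * M , 1+x*M-invertible {k = k} p-prime d≡M*p^k p∤w
              , 1+x*M-fixes (subst (_∣ M * a) (sym d≡M*p^k) (*-monoʳ-∣ M p^k∣a))
              , p^k∤b ∘ 1+x*M-fixes⇒p^k∣ {k = k} p-prime d≡M*p^k p∤x

open Units-1+x*M using (1+x*M-separates)

p∣M⇒p∤1+x*M : ∀ {p} x M → Prime p → p ∣ M → ¬ p ∣ 1 + x * M
p∣M⇒p∤1+x*M x M p-prime p∣M p∣1+x*M = prime∤1 p-prime (∣1+x*M⇒∣M⇒∣1 x M p∣1+x*M p∣M)

-- For odd p, p cannot divide both 1 + M and 1 + 2M, as it would divide their difference M.
∃-p∤x×p∤1+x*M : ∀ {p} M → Prime p → 2 < p ⊎ p ∣ M → ∃ λ x → ¬ p ∣ x × ¬ p ∣ 1 + x * M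
∃-p∤x×p∤1+x*M M p-prime (inj₂ p∣M) = 1 , prime∤1 p-prime , p∣M⇒p∤1+x*M 1 M p-prime p∣M
∃-p∤x×p∤1+x*M {p} M p-prime (inj₁ 2<p) with p ∣? 1 + 1 * M
... | no p∤1+M  = 1 , prime∤1 p-prime , p∤1+M
... | yes p∣1+M = 2 , <⇒≱ 2<p ∘ ∣⇒≤ , λ p∣1+2M →
      p∣M⇒p∤1+x*M 1 M p-prime (∣m+n∣m⇒∣n (subst (p ∣_) 1+2M≡[1+M]+M p∣1+2M) p∣1+M) p∣1+M
  where
  1+2M≡[1+M]+M : 1 + 2 * M ≡ (1 + 1 * M) + M
  1+2M≡[1+M]+M = solve (M ∷ [])

pot-gap⇒separates : ∀ {p a b d} .{{_ : NonZero d}} → Prime p →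
                    pot p (gcd b d) < pot p (gcd a d) →
                    2 < p ⊎ pot p (gcd a d) < pot p d → Separates d a b
pot-gap⇒separates {p} {a} {b} {d} p-prime gap odd⊎room
  with ∣-trans (≤pot⇒p^k∣ p (gcd a d) gap) (gcd[m,n]∣n a d)
... | divides M d≡M*p^k =
  let x , p∤x , p∤w = ∃-p∤x×p∤1+x*M M p-prime (map₂ p∣M odd⊎room) in
  1+x*M-separates {k = k} p-prime d≡M*p^k p^k∣a p^k∤b p∤x p∤w
  where
  k : ℕ
  k = suc (pot p (gcd b d))
  p^k∣a : p ^ k ∣ a
  p^k∣a = ∣-trans (≤pot⇒p^k∣ p (gcd a d) gap) (gcd[m,n]∣m a d)
  p^k∤b : ¬ p ^ k ∣ b
  p^k∤b p^k∣b = pot<⇒p^k∤ p-prime (gcd[m,n]≢0 b d (inj₂ (≢-nonZero⁻¹ d))) ≤-refl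
    (gcd-greatest p^k∣b (divides M d≡M*p^k))
  p∣M : pot p (gcd a d) < pot p d → p ∣ M
  p∣M room = *-cancelʳ-∣ (p ^ k) {{m^n≢0 p k {{prime⇒nonZero p-prime}}}}
    (subst (p ^ suc k ∣_) d≡M*p^k (≤pot⇒p^k∣ p d (≤-trans (s≤s gap) room)))

updateAt-pres-∀ : ∀ {a ℓ} {A : Set a} {m} (P : Fin m → A → Set ℓ) {x y : A} t →
                  P t y → (∀ j → P j x) → ∀ j → P j (updateAt (λ _ → x) t (λ _ → y) j)
updateAt-pres-∀ P {x} t Pty Px j with j ≟ᶠ t
... | yes refl = subst (P t) (sym (updateAt-updates t (λ _ → x))) Pty
... | no j≢t  = subst (P j) (sym (updateAt-minimal j t (λ _ → x) j≢t)) (Px j)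

module Coordinatewise (r : ℕ) (n : Fin r → ℕ) (h : ∀ i → 1 < n i) where
  open Setup r n h
  open ≡-Reasoning

  instance
    n-nonZero : ∀ {i} → NonZero (n i)
    n-nonZero {i} = >-nonZero (<-trans z<s (h i))

  toℕ-· : ∀ a b i → toℕ ((a · b) i) ≡ toℕ (a i) * toℕ (b i) % n i
  toℕ-· a b i = toℕ-fromℕ< _

  toℕ%n : ∀ (a : S) i → toℕ (a i) % n i ≡ toℕ (a i)
  toℕ%n a i = m<n⇒m%n≡m (toℕ<n (a i))

  ≈-sym : ∀ {a b} → a ≈ b → b ≈ a
  ≈-sym a≈b i = sym (a≈b i)

  ≈-trans : ∀ {a b c} → a ≈ b → b ≈ c → a ≈ c
  ≈-trans a≈b b≈c i = trans (a≈b i) (b≈c i)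

  ·-congˡ : ∀ a {b c} → b ≈ c → (a · b) ≈ (a · c)
  ·-congˡ a {b} {c} b≈c i = toℕ-injective (begin
    toℕ ((a · b) i)                 ≡⟨ toℕ-· a b i ⟩
    toℕ (a i) * toℕ (b i) % n i     ≡⟨ cong (λ z → toℕ (a i) * toℕ z % n i) (b≈c i) ⟩
    toℕ (a i) * toℕ (c i) % n i     ≡⟨ toℕ-· a c i ⟨
    toℕ ((a · c) i)                 ∎)

  ·-congʳ : ∀ {a b} c → a ≈ b → (a · c) ≈ (b · c)
  ·-congʳ {a} {b} c a≈b i = toℕ-injective (begin
    toℕ ((a · c) i)                 ≡⟨ toℕ-· a c i ⟩
    toℕ (a i) * toℕ (c i) % n i     ≡⟨ cong (λ z → toℕ z * toℕ (c i) % n i) (a≈b i) ⟩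
    toℕ (b i) * toℕ (c i) % n i     ≡⟨ toℕ-· b c i ⟨
    toℕ ((b · c) i)                 ∎)

  ·-assoc : ∀ a b c → ((a · b) · c) ≈ (a · (b · c))
  ·-assoc a b c i = toℕ-injective (begin
    toℕ (((a · b) · c) i)  ≡⟨ toℕ-· (a · b) c i ⟩
    toℕ ((a · b) i) * C % N ≡⟨ cong (λ z → z * C % N) (toℕ-· a b i) ⟩
    A * B % N * C % N      ≡⟨ [m%d*n]%d≡[m*n]%d (A * B) C N ⟩
    A * B * C % N          ≡⟨ cong (_% N) (*-assoc A B C) ⟩
    A * (B * C) % N        ≡⟨ [m*[n%d]]%d≡[m*n]%d A (B * C) N ⟨
    A * (B * C % N) % N    ≡⟨ cong (λ z → A * z % N) (toℕ-· b c i) ⟨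
    A * toℕ ((b · c) i) % N ≡⟨ toℕ-· a (b · c) i ⟨
    toℕ ((a · (b · c)) i)  ∎)
    where
    N = n i
    A = toℕ (a i)
    B = toℕ (b i)
    C = toℕ (c i)

  ·-identityʳ : ∀ a → (a · one) ≈ a
  ·-identityʳ a i = toℕ-injective (begin
    toℕ ((a · one) i)              ≡⟨ toℕ-· a one i ⟩
    toℕ (a i) * toℕ (one i) % n i  ≡⟨ cong (λ z → toℕ (a i) * z % n i) (toℕ-fromℕ< (h i)) ⟩
    toℕ (a i) * 1 % n i            ≡⟨ cong (_% n i) (*-identityʳ (toℕ (a i))) ⟩
    toℕ (a i) % n i                ≡⟨ toℕ%n a i ⟩
    toℕ (a i)                      ∎)

  ≤H⇒multiple : ∀ {a b} → a ≤H b → ∃ λ c → a ≈ (b · c)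
  ≤H⇒multiple {b = b} (inj₁ a≈b) = one , ≈-trans a≈b (≈-sym (·-identityʳ b))
  ≤H⇒multiple         (inj₂ a≈bc) = a≈bc

  ≤H⇒St⊆ : ∀ {a b} → a ≤H b → St b ⊆St St a
  ≤H⇒St⊆ {b = b} a≤b u (u-unit , ub≈b) with ≤H⇒multiple a≤b
  ... | c , a≈bc = u-unit ,
    ≈-trans (·-congˡ u a≈bc) (≈-trans (≈-sym (·-assoc u b c)) (≈-trans (·-congʳ c ub≈b) (≈-sym a≈bc)))

  gcd-θ : ∀ (a : S) i → gcd (θ a i) (n i) ≡ gcd (toℕ (a i)) (n i)
  gcd-θ a i with toℕ (a i) ≟ 0
  ... | yes aᵢ≡0 rewrite aᵢ≡0 = gcd[n,n]≡gcd[0,n] (n i)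
  ... | no _ = refl

  ≤H⇒gcd∣ : ∀ {a b} → a ≤H b → ∀ i → gcd (κ i (θ b)) (n i) ∣ gcd (κ i (θ a)) (n i)
  ≤H⇒gcd∣ {a} {b} a≤b i with ≤H⇒multiple a≤b
  ... | c , a≈bc = subst₂ _∣_ (sym (gcd-θ b i)) (sym gcd[aᵢ,nᵢ]≡gcd[bᵢcᵢ%nᵢ,nᵢ])
                     (gcd∣gcd[m*n%d] (toℕ (b i)) (toℕ (c i)) (n i))
    where
    gcd[aᵢ,nᵢ]≡gcd[bᵢcᵢ%nᵢ,nᵢ] : gcd (θ a i) (n i) ≡ gcd (toℕ (b i) * toℕ (c i) % n i) (n i)
    gcd[aᵢ,nᵢ]≡gcd[bᵢcᵢ%nᵢ,nᵢ] =
      trans (gcd-θ a i) (cong (λ z → gcd z (n i)) (trans (cong toℕ (a≈bc i)) (toℕ-· b c i)))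

  lift : (Fin r → ℕ) → S
  lift f i = fromℕ< (m%n<n (f i) (n i))

  toℕ-lift : ∀ f i → toℕ (lift f i) ≡ f i % n i
  toℕ-lift f i = toℕ-fromℕ< (m%n<n (f i) (n i))

  toℕ-lift· : ∀ f a i → toℕ ((lift f · a) i) ≡ f i * toℕ (a i) % n i
  toℕ-lift· f a i = begin
    toℕ ((lift f · a) i)          ≡⟨ toℕ-· (lift f) a i ⟩
    toℕ (lift f i) * A % n i      ≡⟨ cong (λ z → z * A % n i) (toℕ-lift f i) ⟩
    f i % n i * A % n i           ≡⟨ [m%d*n]%d≡[m*n]%d (f i) A (n i) ⟩
    f i * A % n i                 ∎
    where A = toℕ (a i)

  gcd∣⇒≤H : ∀ {a b} → (∀ i → gcd (κ i (θ b)) (n i) ∣ gcd (κ i (θ a)) (n i)) → a ≤H b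
  gcd∣⇒≤H {a} {b} gcd∣gcd = inj₂ (lift c , λ i → toℕ-injective (bc≡a i))
    where
    solution : ∀ i → ∃ λ x → toℕ (b i) * x % n i ≡ toℕ (a i) % n i
    solution i = gcd∣⇒solvable (toℕ (b i)) (toℕ (a i)) (n i)
      (∣-trans (subst₂ _∣_ (gcd-θ b i) (gcd-θ a i) (gcd∣gcd i)) (gcd[m,n]∣m _ _))
    c : Fin r → ℕ
    c = proj₁ ∘ solution
    bc≡a : ∀ i → toℕ (a i) ≡ toℕ ((b · lift c) i)
    bc≡a i = begin
      toℕ (a i)                        ≡⟨ toℕ%n a i ⟨
      toℕ (a i) % n i                  ≡⟨ proj₂ (solution i) ⟨
      B * c i % n i                    ≡⟨ [m*[n%d]]%d≡[m*n]%d B (c i) (n i) ⟨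
      B * (c i % n i) % n i            ≡⟨ cong (λ z → B * z % n i) (toℕ-lift c i) ⟨
      B * toℕ (lift c i) % n i         ≡⟨ toℕ-· b (lift c) i ⟨
      toℕ ((b · lift c) i)             ∎
      where B = toℕ (b i)

  lift-isUnit : ∀ {f} → (∀ i → Invertible (n i) (f i)) → IsUnit (lift f)
  lift-isUnit {f} inv = lift g , λ i → toℕ-injective (begin
    toℕ ((lift f · lift g) i)     ≡⟨ toℕ-lift· f (lift g) i ⟩
    f i * toℕ (lift g i) % n i    ≡⟨ cong (λ z → f i * z % n i) (toℕ-lift g i) ⟩
    f i * (g i % n i) % n i       ≡⟨ [m*[n%d]]%d≡[m*n]%d (f i) (g i) (n i) ⟩
    f i * g i % n i               ≡⟨ proj₂ (inv i) ⟩
    1 % n i                       ≡⟨ m<n⇒m%n≡m (h i) ⟩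
    1                             ≡⟨ toℕ-fromℕ< (h i) ⟨
    toℕ (one i)                   ∎)
    where
    g : Fin r → ℕ
    g = proj₁ ∘ inv

  lift-fixes : ∀ {f a} → (∀ i → Fixes (n i) (f i) (toℕ (a i))) → (lift f · a) ≈ a
  lift-fixes {f} {a} fixes i = toℕ-injective (trans (toℕ-lift· f a i) (trans (fixes i) (toℕ%n a i)))

  lift-moves : ∀ {f b} t → ¬ Fixes (n t) (f t) (toℕ (b t)) → ¬ (lift f · b) ≈ b
  lift-moves {f} {b} t moves fb≈b =
    moves (trans (sym (toℕ-lift· f b t)) (trans (cong toℕ (fb≈b t)) (sym (toℕ%n b t))))

  separates⇒St⊄ : ∀ {a b} t → Separates (n t) (toℕ (a t)) (toℕ (b t)) → ∃ λ u → St a u × ¬ St b u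
  separates⇒St⊄ {a} {b} t (w , w-invertible , w-fixes , w-moves) =
    lift f , (lift-isUnit f-invertible , lift-fixes f-fixes) , lift-moves t f-moves ∘ proj₂
    where
    f : Fin r → ℕ
    f = updateAt (λ _ → 1) t (λ _ → w)
    f-invertible : ∀ i → Invertible (n i) (f i)
    f-invertible = updateAt-pres-∀ (λ i → Invertible (n i)) t w-invertible (λ i → 1-invertible (n i))
    f-fixes : ∀ i → Fixes (n i) (f i) (toℕ (a i))
    f-fixes = updateAt-pres-∀ (λ i x → Fixes (n i) x (toℕ (a i))) t w-fixes (λ i → 1-fixes (n i) _)
    f-moves : ¬ Fixes (n t) (f t) (toℕ (b t))
    f-moves = subst (λ x → ¬ Fixes (n t) x (toℕ (b t))) (sym (updateAt-updates t (λ _ → 1))) w-moves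

  PotGap : Fin r → S → S → Set
  PotGap t a b =
    (∃ λ p → Prime p × 2 < p × pot p (gcd (θ b t) (n t)) < pot p (gcd (θ a t) (n t)))
    ⊎ (pot 2 (gcd (θ b t) (n t)) < pot 2 (gcd (θ a t) (n t)) × pot 2 (gcd (θ a t) (n t)) < pot 2 (n t))

  pot-gcd-θ : ∀ p (a : S) t → pot p (gcd (θ a t) (n t)) ≡ pot p (gcd (toℕ (a t)) (n t))
  pot-gcd-θ p a t = cong (pot p) (gcd-θ a t)

  potGap⇒separates : ∀ {a b} t → PotGap t a b → Separates (n t) (toℕ (a t)) (toℕ (b t))
  potGap⇒separates {a} {b} t (inj₁ (p , p-prime , 2<p , gap)) =
    pot-gap⇒separates p-prime (subst₂ _<_ (pot-gcd-θ p b t) (pot-gcd-θ p a t) gap) (inj₁ 2<p)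
  potGap⇒separates {a} {b} t (inj₂ (gap , room)) =
    pot-gap⇒separates prime[2] (subst₂ _<_ (pot-gcd-θ 2 b t) (pot-gcd-θ 2 a t) gap)
      (inj₂ (subst (_< pot 2 (n t)) (pot-gcd-θ 2 a t) room))

lemma2p2 : (r : ℕ) → 1 ≤ r → (n : Fin r → ℕ) → (h : ∀ i → 1 < n i) →
    let open Setup r n h in
    (a b : S) →
      ((a ≤H b) →
        (∀ i → gcd (κ i (θ b)) (n i) ∣ gcd (κ i (θ a)) (n i))
        × (St b ⊆St St a))
      × (((a H b) → ∀ i → gcd (κ i (θ b)) (n i) ≡ gcd (κ i (θ a)) (n i))
        × ((∀ i → gcd (κ i (θ b)) (n i) ≡ gcd (κ i (θ a)) (n i)) → a H b))
      × ((a <H b) →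
        (∃ λ (t : Fin r) →
          (∃ λ p → Prime p × 2 < p
            × pot p (gcd (κ t (θ b)) (n t)) < pot p (gcd (κ t (θ a)) (n t)))
          ⊎ ((pot 2 (gcd (κ t (θ b)) (n t)) < pot 2 (gcd (κ t (θ a)) (n t)))
            × (pot 2 (gcd (κ t (θ a)) (n t)) < pot 2 (n t)))) →
        St b ⊊St St a)
lemma2p2 r _ n h a b =
    (λ a≤b → ≤H⇒gcd∣ a≤b , ≤H⇒St⊆ a≤b)
  , ( (λ (a≤b , b≤a) i → ∣-antisym (≤H⇒gcd∣ a≤b i) (≤H⇒gcd∣ b≤a i))
    , (λ eq → gcd∣⇒≤H (∣-reflexive ∘ eq) , gcd∣⇒≤H (∣-reflexive ∘ sym ∘ eq)) )
  , λ (a≤b , _) (t , gap) → ≤H⇒St⊆ a≤b , separates⇒St⊄ t (potGap⇒separates {a} {b} t gap)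
  where open Coordinatewise r n h
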